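{- (1) Let $k\in\mathbb{N}$, $t$ a term, $v$ a value with $y\notin\mathrm{Fv}(v)$. If $\pi$ is a derivation with conclusion $\Delta\vdash\lambda y.(\lambda x.t)v\colon\biguplus_{i=1}^k[(P_i',P_i)]$, then there is a derivation $\pi'$ with conclusion $\Delta\vdash(\lambda x.\lambda y.t)v\colon\biguplus_{i=1}^k[(P_i',P_i)]$ such that $|\pi'|=|\pi|+1-k$. (2) Let $t,u$ be terms and $v$ a value. If $\pi$ is a derivation with conclusion $\Delta\vdash((\lambda x.t)v)((\lambda x.u)v)\colon P$, then there is a derivation $\pi'$ with conclusion $\Delta\vdash(\lambda x.tu)v\colon P$ such that $|\pi'|=|\pi|-1$.
   Context: Terms: $t ::= x \mid \lambda x.t \mid tu$ (up to $\alpha$); values $v ::= x \mid \lambda x.t$; $\mathrm{Fv}(t)$ free variables. Types: positive types are finite multisets $[(P_1,Q_1),\dots,(P_n,Q_n)]$ of pairs of positive types ($\mathbf{0}$ empty, $\uplus$ multiset union). Environments map variables to positive types (finitely many non-$\mathbf{0}$), combined pointwise by $\uplus$. Rules: (ax) $x\colon P\vdash x\colon P$; ($\lambda$) from $\Gamma_i,x\colon P_i\vdash t\colon Q_i$ ($1\le i\le n$, $n\ge0$) infer $\biguplus_i\Gamma_i\vdash\lambda x.t\colon[(P_1,Q_1),\dots,(P_n,Q_n)]$; ($@$) from $\Gamma\vdash t\colon[(P,Q)]$ and $\Delta\vdash u\colon P$ infer $\Gamma\uplus\Delta\vdash tu\colon Q$. The size $|\pi|$ of a derivation is the number of $@$ rules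 in it. -}

module Defs where

open import Data.Nat using (ℕ; zero; suc; _≟_)
open import Data.Fin using (Fin; zero; suc)
open import Data.List using (List; []; _∷_; _++_)
open import Data.Product using (_×_; _,_)
open import Relation.Nullary using (yes; no; ¬_)
open import Relation.Binary.PropositionalEquality using (_≡_)
open import Data.List.Relation.Binary.Permutation.Homogeneous using (Permutation)

Var : Set
Var = ℕ

infixl 7 _·_
data Term : Set where
  `_  : Var → Term
  ƛ   : Var → Term → Term
  _·_ : Term → Term → Term

data IsValue : Term → Set where
  var : ∀ {x} → IsValue (` x)
  lam : ∀ {x t} → IsValue (ƛ x t)

data _∈Fv_ (y : Var) : Term → Set where
  var  : y ∈Fv (` y)
  lam  : ∀ {x t} → ¬ (y ≡ x) → y ∈Fv t → y ∈Fv ƛ x t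
  appˡ : ∀ {t u} → y ∈Fv t → y ∈Fv (t · u)
  appʳ : ∀ {t u} → y ∈Fv u → y ∈Fv (t · u)

-- Positive types: finite multisets of pairs of positive types.
-- Represented by lists; multiset equality _≈_ is (nested) equality up
-- to permutation.

data PT : Set where
  mk : List (PT × PT) → PT

mutual
  data _≈_ : PT → PT → Set where
    mk : ∀ {xs ys} → Permutation _≈²_ xs ys → mk xs ≈ mk ys

  data _≈²_ : PT × PT → PT × PT → Set where
    _,_ : ∀ {P P' Q Q'} → P ≈ P' → Q ≈ Q' → (P , Q) ≈² (P' , Q')

𝟎 : PT
𝟎 = mk []

infixl 6 _⊎_
_⊎_ : PT → PT → PT
mk xs ⊎ mk ys = mk (xs ++ ys)

[_⇒_] : PT → PT → PT
[ P ⇒ Q ] = mk ((P , Q) ∷ [])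

⨄ : (k : ℕ) → (Fin k → PT) → PT
⨄ zero    F = 𝟎
⨄ (suc k) F = F zero ⊎ ⨄ k (λ i → F (suc i))

Env : Set
Env = Var → PT

_≈ₑ_ : Env → Env → Set
Γ ≈ₑ Δ = ∀ z → Γ z ≈ Δ z

∅ₑ : Env
∅ₑ _ = 𝟎

infixl 6 _⊎ₑ_
_⊎ₑ_ : Env → Env → Env
(Γ ⊎ₑ Δ) z = Γ z ⊎ Δ z

_∶ₑ_ : Var → PT → Env
(x ∶ₑ P) z with z ≟ x
... | yes _ = P
... | no  _ = 𝟎

-- Γ , x : P   (used only when Γ x ≈ 𝟎)
_,,_∶_ : Env → Var → PT → Env
(Γ ,, x ∶ P) z with z ≟ x
... | yes _ = P
... | no  _ = Γ z

-- Derivations.  Since types/environments are multisets, every rule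
-- concludes its judgment up to multiset equality.

infix 4 _⊢_∶_
mutual
  data _⊢_∶_ : Env → Term → PT → Set where
    ax  : ∀ {Γ x P} → Γ ≈ₑ (x ∶ₑ P) → Γ ⊢ ` x ∶ P
    lam : ∀ {Γ Δ x t R ps} → Prems x t Δ ps → Γ ≈ₑ Δ → R ≈ mk ps
        → Γ ⊢ ƛ x t ∶ R
    app : ∀ {Γ Γ₁ Γ₂ t u T P Q R}
        → Γ₁ ⊢ t ∶ T → T ≈ [ P ⇒ Q ] → Γ₂ ⊢ u ∶ P
        → Γ ≈ₑ (Γ₁ ⊎ₑ Γ₂) → R ≈ Q
        → Γ ⊢ t · u ∶ R

  data Prems (x : Var) (t : Term) : Env → List (PT × PT) → Set where
    []  : Prems x t ∅ₑ []
    _∷_ : ∀ {Γ Δ P Q ps}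
        → (Γ x ≈ 𝟎) × ((Γ ,, x ∶ P) ⊢ t ∶ Q)
        → Prems x t Δ ps
        → Prems x t (Γ ⊎ₑ Δ) ((P , Q) ∷ ps)

mutual
  size : ∀ {Γ t P} → Γ ⊢ t ∶ P → ℕ
  size (ax _)             = 0
  size (lam ps _ _)       = sizePs ps
  size (app π _ ρ _ _)    = suc (size π Data.Nat.+ size ρ)

  sizePs : ∀ {x t Δ ps} → Prems x t Δ ps → ℕ
  sizePs []             = 0
  sizePs ((_ , π) ∷ ps) = size π Data.Nat.+ sizePs ps

-- In (1), each of the k premises of λy ends in an @ rule applying λx.t at
-- [(Bᵢ,Pᵢ)] to a typing of v at Bᵢ.  Typings of a value add up (v : A and
-- v : B give v : A ⊎ B, sizes adding), so the k typings of v merge into one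
-- at ⨄ Bᵢ; and since y ∉ Fv(v), every hypothesis y : P'ᵢ lies in the typing
-- of t.  Rebuilding λy.t from the typings of t, closing it with λx and
-- applying it once to the merged typing of v turns k @ rules into one.
-- In (2) the two typings of v merge likewise and two @ rules become one.
module Submission where

open import Defs
open import Algebra.Bundles using (CommutativeMonoid)
open import Data.Nat using (ℕ; zero; suc; _+_; _≟_)
open import Data.Nat.Properties using (+-assoc; +-identityʳ)
open import Data.Nat.Tactic.RingSolver using (solve-∀)
open import Data.Fin as Fin using (Fin)
open import Data.List using (List; []; _∷_; _++_; length)
open import Data.List.Properties using (length-++)
open import Data.List.Relation.Unary.Any using (here)
open import Data.List.Relation.Binary.Pointwise.Base using (Pointwise; []; _∷_)
open import Data.List.Relation.Binary.Permutation.Homogeneous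
  using (Permutation; refl; prep; swap; trans)
open import Data.Product using (Σ; _×_; _,_; proj₁; proj₂)
open import Data.Empty using (⊥-elim)
open import Function using (_∘_)
open import Relation.Nullary using (¬_; Dec; yes; no)
open import Relation.Binary.Bundles using (Setoid)
open import Relation.Binary.PropositionalEquality as ≡
  using (_≡_; refl; cong; cong₂; sym; subst)

mutual
  ≈-refl : ∀ {A} → A ≈ A
  ≈-refl {mk xs} = mk (refl (≈²-pointwise-refl xs))

  ≈²-pointwise-refl : ∀ xs → Pointwise _≈²_ xs xs
  ≈²-pointwise-refl []       = []
  ≈²-pointwise-refl (_ ∷ xs) = (≈-refl , ≈-refl) ∷ ≈²-pointwise-refl xs

mutual
  ≈-sym : ∀ {A B} → A ≈ B → B ≈ A
  ≈-sym (mk p) = mk (≈²-permutation-sym p)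

  ≈²-sym : ∀ {a b} → a ≈² b → b ≈² a
  ≈²-sym (e , f) = ≈-sym e , ≈-sym f

  ≈²-pointwise-sym : ∀ {xs ys} → Pointwise _≈²_ xs ys → Pointwise _≈²_ ys xs
  ≈²-pointwise-sym []       = []
  ≈²-pointwise-sym (e ∷ es) = ≈²-sym e ∷ ≈²-pointwise-sym es

  ≈²-permutation-sym : ∀ {xs ys} → Permutation _≈²_ xs ys → Permutation _≈²_ ys xs
  ≈²-permutation-sym (refl es)    = refl (≈²-pointwise-sym es)
  ≈²-permutation-sym (prep e p)   = prep (≈²-sym e) (≈²-permutation-sym p)
  ≈²-permutation-sym (swap e f p) = swap (≈²-sym f) (≈²-sym e) (≈²-permutation-sym p)
  ≈²-permutation-sym (trans p q)  = trans (≈²-permutation-sym q) (≈²-permutation-sym p)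

≈-trans : ∀ {A B C} → A ≈ B → B ≈ C → A ≈ C
≈-trans (mk p) (mk q) = mk (trans p q)

≈²-setoid : Setoid _ _
≈²-setoid = record
  { _≈_           = _≈²_
  ; isEquivalence = record
    { refl  = ≈-refl , ≈-refl
    ; sym   = ≈²-sym
    ; trans = λ { (e , f) (e' , f') → ≈-trans e e' , ≈-trans f f' }
    }
  }

import Data.List.Relation.Binary.Permutation.Setoid.Properties ≈²-setoid as ↭

⊎-commutativeMonoid : CommutativeMonoid _ _
⊎-commutativeMonoid = record
  { _≈_ = _≈_
  ; _∙_ = _⊎_
  ; ε   = 𝟎
  ; isCommutativeMonoid = record
    { isMonoid = record
      { isSemigroup = record
        { isMagma = record
          { isEquivalence = record { refl = ≈-refl ; sym = ≈-sym ; trans = ≈-trans }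
          ; ∙-cong        = λ { (mk p) (mk q) → mk (↭.++⁺ p q) }
          }
        ; assoc = λ { (mk xs) (mk ys) (mk zs) → mk (↭.++-assoc xs ys zs) }
        }
      ; identity = (λ { (mk _) → ≈-refl }) , λ { (mk xs) → mk (proj₂ ↭.++-identity xs) }
      }
    ; comm = λ { (mk xs) (mk ys) → mk (↭.++-comm xs ys) }
    }
  }

open CommutativeMonoid ⊎-commutativeMonoid
  using (setoid; commutativeSemigroup)
  renaming ( reflexive to ≈-reflexive; ∙-cong to ⊎-cong; assoc to ⊎-assoc
           ; identityˡ to ⊎-identityˡ; identityʳ to ⊎-identityʳ )
open import Algebra.Properties.CommutativeSemigroup commutativeSemigroup
  using () renaming (interchange to ⊎-interchange)

import Relation.Binary.Reasoning.Setoid setoid as ≈-Reasoning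

↭-singleton : ∀ {xs a} → Permutation _≈²_ xs (a ∷ []) → Σ _ λ b → xs ≡ b ∷ [] × b ≈² a
-- Matching on the length equation is what forces xs to be a singleton.
↭-singleton {xs} p with ↭.xs↭ys⇒|xs|≡|ys| p
↭-singleton {b ∷ []} p | _
  with ↭.Any-resp-↭ {P = b ≈²_} (λ e f → Setoid.trans ≈²-setoid f e) p (here (Setoid.refl ≈²-setoid))
... | here e = b , refl , e

card : PT → ℕ
card (mk xs) = length xs

card-resp-≈ : ∀ {A B} → A ≈ B → card A ≡ card B
card-resp-≈ (mk p) = ↭.xs↭ys⇒|xs|≡|ys| p

card-⊎ : ∀ A B → card (A ⊎ B) ≡ card A + card B
card-⊎ (mk xs) (mk ys) = length-++ xs

card-⨄-singletons : ∀ k (P' P : Fin k → PT) → card (⨄ k (λ i → [ P' i ⇒ P i ])) ≡ k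
card-⨄-singletons zero    P' P = refl
card-⨄-singletons (suc k) P' P = ≡.trans
  (card-⊎ [ P' Fin.zero ⇒ P Fin.zero ] (⨄ k (λ i → [ P' (Fin.suc i) ⇒ P (Fin.suc i) ])))
  (cong suc (card-⨄-singletons k (P' ∘ Fin.suc) (P ∘ Fin.suc)))

,,-here : ∀ Γ x P → (Γ ,, x ∶ P) x ≡ P
,,-here Γ x P with x ≟ x
... | yes _ = refl
... | no x≢x = ⊥-elim (x≢x refl)

,,-there : ∀ Γ x P {z} → ¬ z ≡ x → (Γ ,, x ∶ P) z ≡ Γ z
,,-there Γ x P {z} z≢x with z ≟ x
... | yes z≡x = ⊥-elim (z≢x z≡x)
... | no _    = refl

,,-⊎ : ∀ Γ Δ x A B z → ((Γ ⊎ₑ Δ) ,, x ∶ (A ⊎ B)) z ≡ ((Γ ,, x ∶ A) ⊎ₑ (Δ ,, x ∶ B)) z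
,,-⊎ Γ Δ x A B z with z ≟ x
... | yes _ = refl
... | no _  = refl

,,-restore : ∀ Γ x B {A} → A ≈ Γ x → ((Γ ,, x ∶ B) ,, x ∶ A) ≈ₑ Γ
,,-restore Γ x B {A} A≈Γx z = by-cases (z ≟ x)
  where
  by-cases : Dec (z ≡ x) → ((Γ ,, x ∶ B) ,, x ∶ A) z ≈ Γ z
  by-cases (yes refl) = subst (_≈ Γ z) (sym (,,-here _ z _)) A≈Γx
  by-cases (no z≢x)   = ≈-reflexive (≡.trans (,,-there _ x _ z≢x) (,,-there Γ x B z≢x))

,,-split-here : ∀ {Γ Γ' V y B} → V y ≈ 𝟎 → (Γ ,, y ∶ B) ≈ₑ (Γ' ⊎ₑ V) → B ≈ Γ' y
,,-split-here {Γ} {Γ'} {y = y} {B} Vy≈𝟎 split = begin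
  B                ≡⟨ sym (,,-here Γ y B) ⟩
  (Γ ,, y ∶ B) y   ≈⟨ split y ⟩
  Γ' y ⊎ _         ≈⟨ ⊎-cong ≈-refl Vy≈𝟎 ⟩
  Γ' y ⊎ 𝟎         ≈⟨ ⊎-identityʳ _ ⟩
  Γ' y             ∎
  where open ≈-Reasoning

,,-split-there : ∀ {Γ Γ' V y B z} → (Γ ,, y ∶ B) ≈ₑ (Γ' ⊎ₑ V) → ¬ z ≡ y → Γ z ≈ (Γ' z ⊎ V z)
,,-split-there {Γ} {y = y} {B} {z} split z≢y =
  ≈-trans (≈-reflexive (sym (,,-there Γ y B z≢y))) (split z)

∶ₑ-there : ∀ x P {z} → ¬ z ≡ x → (x ∶ₑ P) z ≡ 𝟎
∶ₑ-there x P {z} z≢x with z ≟ x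
... | yes z≡x = ⊥-elim (z≢x z≡x)
... | no _    = refl

∶ₑ-cong : ∀ x {A B} → A ≈ B → ∀ z → (x ∶ₑ A) z ≈ (x ∶ₑ B) z
∶ₑ-cong x A≈B z with z ≟ x
... | yes _ = A≈B
... | no _  = ≈-refl

∶ₑ-⊎ : ∀ x A B z → ((x ∶ₑ A) ⊎ₑ (x ∶ₑ B)) z ≈ (x ∶ₑ (A ⊎ B)) z
∶ₑ-⊎ x A B z with z ≟ x
... | yes _ = ≈-refl
... | no _  = ≈-refl

≈ₑ-trans : ∀ {Γ Δ Θ} → Γ ≈ₑ Δ → Δ ≈ₑ Θ → Γ ≈ₑ Θ
≈ₑ-trans Γ≈Δ Δ≈Θ z = ≈-trans (Γ≈Δ z) (Δ≈Θ z)

⊢-resp-≈ₑ : ∀ {Γ Γ' t P} → Γ' ≈ₑ Γ → Γ ⊢ t ∶ P → Γ' ⊢ t ∶ P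
⊢-resp-≈ₑ e (ax Γ≈)          = ax (≈ₑ-trans e Γ≈)
⊢-resp-≈ₑ e (lam ps Γ≈ R≈)   = lam ps (≈ₑ-trans e Γ≈) R≈
⊢-resp-≈ₑ e (app π T≈ ρ Γ≈ R≈) = app π T≈ ρ (≈ₑ-trans e Γ≈) R≈

size-⊢-resp-≈ₑ : ∀ {Γ Γ' t P} (e : Γ' ≈ₑ Γ) (π : Γ ⊢ t ∶ P) → size (⊢-resp-≈ₑ e π) ≡ size π
size-⊢-resp-≈ₑ e (ax _)          = refl
size-⊢-resp-≈ₑ e (lam _ _ _)     = refl
size-⊢-resp-≈ₑ e (app _ _ _ _ _) = refl

⊢-resp-≈ : ∀ {Γ t P P'} → P' ≈ P → Γ ⊢ t ∶ P → Γ ⊢ t ∶ P'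
⊢-resp-≈ e (ax {x = x} Γ≈)     = ax (λ z → ≈-trans (Γ≈ z) (∶ₑ-cong x (≈-sym e) z))
⊢-resp-≈ e (lam ps Γ≈ R≈)      = lam ps Γ≈ (≈-trans e R≈)
⊢-resp-≈ e (app π T≈ ρ Γ≈ R≈) = app π T≈ ρ Γ≈ (≈-trans e R≈)

size-⊢-resp-≈ : ∀ {Γ t P P'} (e : P' ≈ P) (π : Γ ⊢ t ∶ P) → size (⊢-resp-≈ e π) ≡ size π
size-⊢-resp-≈ e (ax _)          = refl
size-⊢-resp-≈ e (lam _ _ _)     = refl
size-⊢-resp-≈ e (app _ _ _ _ _) = refl

mutual
  ∉Fv⇒≈𝟎 : ∀ {y Γ s P} → ¬ y ∈Fv s → Γ ⊢ s ∶ P → Γ y ≈ 𝟎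
  ∉Fv⇒≈𝟎 {y} y∉ (ax {x = x} Γ≈) with y ≟ x
  ... | yes refl = ⊥-elim (y∉ var)
  ... | no y≢x   = subst (_ ≈_) (∶ₑ-there x _ y≢x) (Γ≈ y)
  ∉Fv⇒≈𝟎 {y} y∉ (lam ps Γ≈ _) = ≈-trans (Γ≈ y) (∉Fv⇒Prems≈𝟎 y∉ ps)
  ∉Fv⇒≈𝟎 {y} y∉ (app π _ ρ Γ≈ _) =
    ≈-trans (Γ≈ y) (⊎-cong (∉Fv⇒≈𝟎 (y∉ ∘ appˡ) π) (∉Fv⇒≈𝟎 (y∉ ∘ appʳ) ρ))

  ∉Fv⇒Prems≈𝟎 : ∀ {y x s Δ ps} → ¬ y ∈Fv ƛ x s → Prems x s Δ ps → Δ y ≈ 𝟎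
  ∉Fv⇒Prems≈𝟎 y∉ [] = ≈-refl
  ∉Fv⇒Prems≈𝟎 {y} {x} y∉ ((Γx≈𝟎 , π) ∷ ps) with y ≟ x
  ... | yes refl = ⊎-cong Γx≈𝟎 (∉Fv⇒Prems≈𝟎 y∉ ps)
  ... | no y≢x   = ⊎-cong (subst (_≈ 𝟎) (,,-there _ x _ y≢x) (∉Fv⇒≈𝟎 (y∉ ∘ lam y≢x) π))
                          (∉Fv⇒Prems≈𝟎 y∉ ps)

record Prems-++ (x : Var) (t : Term) (Δ₁ Δ₂ : Env) (ps : List (PT × PT)) (n : ℕ) : Set where
  field
    {Δ}   : Env
    prems : Prems x t Δ ps
    Δ≈    : Δ ≈ₑ (Δ₁ ⊎ₑ Δ₂)
    size≡ : sizePs prems ≡ n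

prems-++ : ∀ {x t Δ₁ Δ₂ ps₁ ps₂} (p : Prems x t Δ₁ ps₁) (q : Prems x t Δ₂ ps₂)
         → Prems-++ x t Δ₁ Δ₂ (ps₁ ++ ps₂) (sizePs p + sizePs q)
prems-++ [] q = record { prems = q ; Δ≈ = λ _ → ≈-sym (⊎-identityˡ _) ; size≡ = refl }
prems-++ {Δ₂ = Δ₂} (prem@(_ , π) ∷ p) q = record
  { prems = prem ∷ prems
  ; Δ≈    = λ z → ≈-trans (⊎-cong ≈-refl (Δ≈ z)) (≈-sym (⊎-assoc _ _ (Δ₂ z)))
  ; size≡ = ≡.trans (cong (size π +_) size≡) (sym (+-assoc (size π) _ _))
  }
  where open Prems-++ (prems-++ p q)

value-𝟎 : ∀ {v} → IsValue v → Σ (∅ₑ ⊢ v ∶ 𝟎) λ π → size π ≡ 0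
value-𝟎 (var {x}) = ax (λ z → ≈-sym (x∶𝟎≈𝟎 z)) , refl
  where
  x∶𝟎≈𝟎 : ∀ z → (x ∶ₑ 𝟎) z ≈ 𝟎
  x∶𝟎≈𝟎 z with z ≟ x
  ... | yes _ = ≈-refl
  ... | no _  = ≈-refl
value-𝟎 lam = lam [] (λ _ → ≈-refl) ≈-refl , refl

value-⊎ : ∀ {v Γ₁ Γ₂ A₁ A₂} → IsValue v → (π₁ : Γ₁ ⊢ v ∶ A₁) (π₂ : Γ₂ ⊢ v ∶ A₂)
        → Σ ((Γ₁ ⊎ₑ Γ₂) ⊢ v ∶ (A₁ ⊎ A₂)) λ π → size π ≡ size π₁ + size π₂
value-⊎ var (ax {x = x} {P = A₁} Γ₁≈) (ax {P = A₂} Γ₂≈) =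
  ax (λ z → ≈-trans (⊎-cong (Γ₁≈ z) (Γ₂≈ z)) (∶ₑ-⊎ x A₁ A₂ z)) , refl
value-⊎ lam (lam p₁ Γ₁≈ R₁≈) (lam p₂ Γ₂≈ R₂≈) =
  lam prems (λ z → ≈-trans (⊎-cong (Γ₁≈ z) (Γ₂≈ z)) (≈-sym (Δ≈ z))) (⊎-cong R₁≈ R₂≈) , size≡
  where open Prems-++ (prems-++ p₁ p₂)

record ƛ-Inversion (Γ : Env) (x : Var) (t : Term) (B Q : PT) (n : ℕ) : Set where
  field
    {Γ'}    : Env
    {B' Q'} : PT
    Γ'x≈𝟎   : Γ' x ≈ 𝟎
    body    : (Γ' ,, x ∶ B') ⊢ t ∶ Q'
    B'≈     : B' ≈ B
    Q'≈     : Q' ≈ Q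
    Γ≈      : Γ ≈ₑ Γ'
    size≡   : size body ≡ n

ƛ-inversion : ∀ {Γ x t T B Q} (π : Γ ⊢ ƛ x t ∶ T) → T ≈ [ B ⇒ Q ]
            → ƛ-Inversion Γ x t B Q (size π)
ƛ-inversion (lam prems Γ≈ R≈) T≈ with ≈-trans (≈-sym R≈) T≈
... | mk p with ↭-singleton p
... | _ , refl , (B'≈ , Q'≈) with prems
... | (Γ'x≈𝟎 , body) ∷ [] = record
  { Γ'x≈𝟎 = Γ'x≈𝟎 ; body = body ; B'≈ = B'≈ ; Q'≈ = Q'≈
  ; Γ≈ = λ z → ≈-trans (Γ≈ z) (⊎-identityʳ _) ; size≡ = sym (+-identityʳ _) }

record Redex-Inversion (Θ : Env) (x : Var) (t v : Term) (C : PT) (n : ℕ) : Set where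
  field
    {Γ V}  : Env
    {B}    : PT
    Γx≈𝟎   : Γ x ≈ 𝟎
    body   : (Γ ,, x ∶ B) ⊢ t ∶ C
    arg    : V ⊢ v ∶ B
    Θ≈     : Θ ≈ₑ (Γ ⊎ₑ V)
    size≡  : suc (size body + size arg) ≡ n

redex-inversion : ∀ {Θ x t v C} (π : Θ ⊢ (ƛ x t) · v ∶ C) → Redex-Inversion Θ x t v C (size π)
redex-inversion {x = x} {t} {v} {C} (app {Γ₂ = V} πλ T≈ πv Θ≈ R≈) = record
  { Γx≈𝟎  = I.Γ'x≈𝟎
  ; body  = body
  ; arg   = arg
  ; Θ≈    = λ z → ≈-trans (Θ≈ z) (⊎-cong (I.Γ≈ z) ≈-refl)
  ; size≡ = size≡
  }
  where
  module I = ƛ-Inversion (ƛ-inversion πλ T≈)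
  C≈Q' = ≈-trans R≈ (≈-sym I.Q'≈)
  body : (I.Γ' ,, x ∶ I.B') ⊢ t ∶ C
  body = ⊢-resp-≈ C≈Q' I.body
  arg : V ⊢ v ∶ I.B'
  arg = ⊢-resp-≈ I.B'≈ πv
  size≡ : suc (size body + size arg) ≡ suc (size πλ + size πv)
  size≡ rewrite size-⊢-resp-≈ C≈Q' I.body | size-⊢-resp-≈ I.B'≈ πv | I.size≡ = refl

redex-·-redex-merge : ∀ (x : Var) (t u v : Term) → IsValue v → (Δ : Env) (P : PT)
  → (π : Δ ⊢ ((ƛ x t) · v) · ((ƛ x u) · v) ∶ P)
  → Σ (Δ ⊢ (ƛ x (t · u)) · v ∶ P) λ π' → size π' + 1 ≡ size π
redex-·-redex-merge x t u v isV Δ P (app {Γ₁ = Γ₁} {Γ₂} πt F≈ πu Δ≈ R≈) = π' , size≡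
  where
  module T = Redex-Inversion (redex-inversion πt)
  module U = Redex-Inversion (redex-inversion πu)
  πtu = app T.body F≈ U.body (λ z → ≈-reflexive (,,-⊎ T.Γ U.Γ x T.B U.B z)) R≈
  πλtu : ((T.Γ ⊎ₑ U.Γ) ⊎ₑ ∅ₑ) ⊢ ƛ x (t · u) ∶ [ T.B ⊎ U.B ⇒ P ]
  πλtu = lam ((⊎-cong T.Γx≈𝟎 U.Γx≈𝟎 , πtu) ∷ []) (λ _ → ≈-refl) ≈-refl
  merged = value-⊎ isV T.arg U.arg
  Δ≈' : ∀ z → Δ z ≈ (((T.Γ z ⊎ U.Γ z) ⊎ 𝟎) ⊎ (T.V z ⊎ U.V z))
  Δ≈' z = begin
    Δ z                                     ≈⟨ Δ≈ z ⟩
    Γ₁ z ⊎ Γ₂ z                             ≈⟨ ⊎-cong (T.Θ≈ z) (U.Θ≈ z) ⟩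
    (T.Γ z ⊎ T.V z) ⊎ (U.Γ z ⊎ U.V z)       ≈⟨ ⊎-interchange _ _ _ _ ⟩
    (T.Γ z ⊎ U.Γ z) ⊎ (T.V z ⊎ U.V z)       ≈⟨ ⊎-cong (≈-sym (⊎-identityʳ _)) ≈-refl ⟩
    ((T.Γ z ⊎ U.Γ z) ⊎ 𝟎) ⊎ (T.V z ⊎ U.V z) ∎
    where open ≈-Reasoning
  π' = app πλtu ≈-refl (proj₁ merged) Δ≈' ≈-refl
  size≡ : size π' + 1 ≡ suc (size πt + size πu)
  size≡ rewrite proj₂ merged =
    ≡.trans (arithmetic (size T.body) (size T.arg) (size U.body) (size U.arg))
            (cong suc (cong₂ _+_ T.size≡ U.size≡))
    where
    arithmetic : ∀ a b c d → suc ((suc (a + c) + 0) + (b + d)) + 1 ≡ suc (suc (a + b) + suc (c + d))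
    arithmetic = solve-∀

-- Premises of λy.t and one typing of v that together rebuild (λx.λy.t)v
-- from the premises of λy.(λx.t)v.  Away from x the context Δ splits as
-- H ⊎ V; at x only v contributes, because x is bound by the λx.t it came from.
record Commuted (x y : Var) (t v : Term) (Δ : Env) (ps : List (PT × PT)) (n : ℕ) : Set where
  field
    {H V}  : Env
    {A}    : PT
    prems  : Prems y t H ps
    value  : V ⊢ v ∶ A
    A≈Hx   : A ≈ H x
    Δx≈    : Δ x ≈ V x
    Δ≈     : ∀ {z} → ¬ z ≡ x → Δ z ≈ (H z ⊎ V z)
    size≡  : sizePs prems + size value + length ps ≡ n

commuted-[] : ∀ {x y t v} → IsValue v → Commuted x y t v ∅ₑ [] 0
commuted-[] isV = record
  { prems = [] ; value = proj₁ (value-𝟎 isV)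
  ; A≈Hx = ≈-refl ; Δx≈ = ≈-refl ; Δ≈ = λ _ → ≈-refl
  ; size≡ = cong (_+ 0) (proj₂ (value-𝟎 isV)) }

commuted-++ : ∀ {x y t v Δ₁ Δ₂ ps₁ ps₂ n₁ n₂} → IsValue v
            → Commuted x y t v Δ₁ ps₁ n₁ → Commuted x y t v Δ₂ ps₂ n₂
            → Commuted x y t v (Δ₁ ⊎ₑ Δ₂) (ps₁ ++ ps₂) (n₁ + n₂)
commuted-++ {x = x} {ps₁ = ps₁} {ps₂} isV c₁ c₂ = record
  { prems = P.prems
  ; value = proj₁ merged
  ; A≈Hx  = ≈-trans (⊎-cong C₁.A≈Hx C₂.A≈Hx) (≈-sym (P.Δ≈ x))
  ; Δx≈   = ⊎-cong C₁.Δx≈ C₂.Δx≈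
  ; Δ≈    = λ {z} z≢x → ≈-trans (⊎-cong (C₁.Δ≈ z≢x) (C₂.Δ≈ z≢x))
                          (≈-trans (⊎-interchange _ _ _ _) (⊎-cong (≈-sym (P.Δ≈ z)) ≈-refl))
  ; size≡ = size≡
  }
  where
  module C₁ = Commuted c₁
  module C₂ = Commuted c₂
  module P = Prems-++ (prems-++ C₁.prems C₂.prems)
  merged = value-⊎ isV C₁.value C₂.value
  size≡ : sizePs P.prems + size (proj₁ merged) + length (ps₁ ++ ps₂) ≡ _
  size≡ rewrite P.size≡ | proj₂ merged | length-++ ps₁ {ps₂} =
    ≡.trans (arithmetic (sizePs C₁.prems) (sizePs C₂.prems) (size C₁.value) (size C₂.value)
                        (length ps₁) (length ps₂))
            (cong₂ _+_ C₁.size≡ C₂.size≡)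
    where
    arithmetic : ∀ s₁ s₂ w₁ w₂ l₁ l₂ → s₁ + s₂ + (w₁ + w₂) + (l₁ + l₂) ≡ (s₁ + w₁ + l₁) + (s₂ + w₂ + l₂)
    arithmetic = solve-∀

commute-premise : ∀ {x y t v Γ B C} → ¬ x ≡ y → ¬ y ∈Fv v → Γ y ≈ 𝟎
                → (π : (Γ ,, y ∶ B) ⊢ (ƛ x t) · v ∶ C)
                → Commuted x y t v Γ ((B , C) ∷ []) (size π)
commute-premise {x} {y} {Γ = Γ} {B} x≢y y∉v Γy≈𝟎 π = record
  { prems = (Hy≈𝟎 , body) ∷ []
  ; value = R.arg
  ; A≈Hx  = ≈-trans (≈-reflexive (sym Hx≡B)) (≈-sym (⊎-identityʳ _))
  ; Δx≈   = Γx≈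
  ; Δ≈    = Γ≈
  ; size≡ = size≡
  }
  where
  module R = Redex-Inversion (redex-inversion π)
  E = R.Γ ,, x ∶ R.B
  H = E ,, y ∶ 𝟎
  Vy≈𝟎 : R.V y ≈ 𝟎
  Vy≈𝟎 = ∉Fv⇒≈𝟎 y∉v R.arg
  Hy≈𝟎 : H y ≈ 𝟎
  Hy≈𝟎 = ≈-reflexive (,,-here E y 𝟎)
  Hx≡B : H x ≡ R.B
  Hx≡B = ≡.trans (,,-there E y 𝟎 x≢y) (,,-here R.Γ x R.B)
  B≈Ey : B ≈ E y
  B≈Ey = ≈-trans (,,-split-here Vy≈𝟎 R.Θ≈) (≈-reflexive (sym (,,-there R.Γ x R.B (x≢y ∘ sym))))
  body = ⊢-resp-≈ₑ (,,-restore E y 𝟎 B≈Ey) R.body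
  Γx≈ : Γ x ≈ R.V x
  Γx≈ = ≈-trans (,,-split-there R.Θ≈ x≢y) (≈-trans (⊎-cong R.Γx≈𝟎 ≈-refl) (⊎-identityˡ _))
  Γ≈ : ∀ {z} → ¬ z ≡ x → Γ z ≈ ((H z ⊎ 𝟎) ⊎ R.V z)
  Γ≈ {z} z≢x = by-cases (z ≟ y)
    where
    by-cases : Dec (z ≡ y) → Γ z ≈ ((H z ⊎ 𝟎) ⊎ R.V z)
    by-cases (yes refl) = ≈-trans Γy≈𝟎 (≈-sym (⊎-cong (⊎-cong Hy≈𝟎 ≈-refl) Vy≈𝟎))
    by-cases (no z≢y)   = ≈-trans (,,-split-there R.Θ≈ z≢y) (⊎-cong Γz≈Hz⊎𝟎 ≈-refl)
      where
      Γz≈Hz⊎𝟎 : R.Γ z ≈ (H z ⊎ 𝟎)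
      Γz≈Hz⊎𝟎 = ≈-sym (≈-trans (⊎-identityʳ _)
        (≈-reflexive (≡.trans (,,-there E y 𝟎 z≢y) (,,-there R.Γ x R.B z≢x))))
  size≡ : (size body + 0) + size R.arg + 1 ≡ size π
  size≡ rewrite size-⊢-resp-≈ₑ (,,-restore E y 𝟎 B≈Ey) R.body =
    ≡.trans (arithmetic (size R.body) (size R.arg)) R.size≡
    where
    arithmetic : ∀ a b → (a + 0) + b + 1 ≡ suc (a + b)
    arithmetic = solve-∀

commute-prems : ∀ {x y t v Δ ps} → ¬ x ≡ y → IsValue v → ¬ y ∈Fv v
              → (prems : Prems y ((ƛ x t) · v) Δ ps) → Commuted x y t v Δ ps (sizePs prems)
commute-prems x≢y isV y∉v [] = commuted-[] isV
commute-prems x≢y isV y∉v ((Γy≈𝟎 , π) ∷ prems) =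
  commuted-++ isV (commute-premise x≢y y∉v Γy≈𝟎 π) (commute-prems x≢y isV y∉v prems)

ƛ-redex-commute : ∀ (k : ℕ) (P' P : Fin k → PT) (x y : Var) (t v : Term)
  → ¬ (x ≡ y) → IsValue v → ¬ (y ∈Fv v) → (Δ : Env)
  → (π : Δ ⊢ ƛ y ((ƛ x t) · v) ∶ ⨄ k (λ i → [ P' i ⇒ P i ]))
  → Σ (Δ ⊢ (ƛ x (ƛ y t)) · v ∶ ⨄ k (λ i → [ P' i ⇒ P i ])) λ π' → size π' + k ≡ size π + 1
ƛ-redex-commute k P' P x y t v x≢y isV y∉v Δ (lam {ps = ps} prems Δ≈ R≈) = π' , size≡
  where
  module C = Commuted (commute-prems x≢y isV y∉v prems)
  L = C.H ,, x ∶ 𝟎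
  πλy = lam C.prems (,,-restore C.H x 𝟎 C.A≈Hx) R≈
  πλx : (L ⊎ₑ ∅ₑ) ⊢ ƛ x (ƛ y t) ∶ [ C.A ⇒ ⨄ k (λ i → [ P' i ⇒ P i ]) ]
  πλx = lam ((≈-reflexive (,,-here C.H x 𝟎) , πλy) ∷ []) (λ _ → ≈-refl) ≈-refl
  Δ≈' : ∀ z → Δ z ≈ ((L z ⊎ 𝟎) ⊎ C.V z)
  Δ≈' z = by-cases (z ≟ x)
    where
    by-cases : Dec (z ≡ x) → Δ z ≈ ((L z ⊎ 𝟎) ⊎ C.V z)
    by-cases (yes refl) = ≈-trans (Δ≈ z) (≈-trans C.Δx≈
      (≈-sym (≈-trans (⊎-cong (⊎-cong Lx≈𝟎 ≈-refl) ≈-refl) (⊎-identityˡ _))))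
      where Lx≈𝟎 = ≈-reflexive (,,-here C.H x 𝟎)
    by-cases (no z≢x)   = ≈-trans (Δ≈ z) (≈-trans (C.Δ≈ z≢x)
      (⊎-cong (≈-sym (≈-trans (⊎-identityʳ _) (≈-reflexive (,,-there C.H x 𝟎 z≢x)))) ≈-refl))
  π' = app πλx ≈-refl C.value Δ≈' ≈-refl
  k≡length : k ≡ length ps
  k≡length = ≡.trans (sym (card-⨄-singletons k P' P)) (card-resp-≈ R≈)
  size≡ : size π' + k ≡ sizePs prems + 1
  size≡ rewrite k≡length =
    ≡.trans (arithmetic (sizePs C.prems) (size C.value) (length ps)) (cong (_+ 1) C.size≡)
    where
    arithmetic : ∀ s w l → suc ((s + 0) + w) + l ≡ (s + w + l) + 1
    arithmetic = solve-∀

mainTheorem20 :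
    (∀ (k : ℕ) (P' P : Fin k → PT) (x y : Var) (t v : Term)
       → ¬ (x ≡ y) → IsValue v → ¬ (y ∈Fv v) → (Δ : Env)
       → (π : Δ ⊢ ƛ y ((ƛ x t) · v) ∶ ⨄ k (λ i → [ P' i ⇒ P i ]))
       → Σ (Δ ⊢ (ƛ x (ƛ y t)) · v ∶ ⨄ k (λ i → [ P' i ⇒ P i ])) λ π'
           → size π' + k ≡ size π + 1)
    ×
    (∀ (x : Var) (t u v : Term) → IsValue v → (Δ : Env) (P : PT)
       → (π : Δ ⊢ ((ƛ x t) · v) · ((ƛ x u) · v) ∶ P)
       → Σ (Δ ⊢ (ƛ x (t · u)) · v ∶ P) λ π'
           → size π' + 1 ≡ size π)
mainTheorem20 = ƛ-redex-commute , redex-·-redex-merge
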